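{- Let $G=(P,N,E)$ be a proper tagged probe interval graph such that $G_P$ is a connected proper interval graph with a canonical ordering of blocks $B_1,B_2,\dots,B_t$, and let $\mathcal{V}$ be the corresponding vertex canonical sequence of blocks of $G_P$. Let $w\in N$ have at least two block-neighbors in $G_P$, and let $T_1$ and $T_2$ be two perfect block substrings for $w$ in $\mathcal{V}$ intersecting in exactly one place. Then one of the following holds: (1) $\mathcal{V}$ begins with $B_1B_2B_1$ and only $B_1$ and $B_2$ are block-neighbors of $w$; (2) $\mathcal{V}$ ends with $B_tB_{t-1}B_t$ and only $B_{t-1}$ and $B_t$ are block-neighbors of $w$.
   Context: $G_P$ is the subgraph induced by $P$. A proper tagged probe interval graph with probes $P$ and nonprobes $N$ is a graph for which there are closed intervals $I_x=[\ell_x,r_x]$ such that $N$ is independent; for $x,y\in P$, $xy\in E$ iff $I_x\cap I_y\ne\emptyset$; for $x\in P,y\in N$, $xy\in E$ iff $\ell_x\in I_y$ or $r_x\in I_y$; and $\{I_x:x\in P\}$ is a proper interval representation of $G_P$. Blocks of $G_P$ are the classes of vertices with identical closed neighborhoods; the reduced graph $\widetilde{G_P}$ merges each block into one vertex. A canonical ordering of blocks is a canonical ordering of the vertices of $\widetilde{G_P}$, where a canonical ordering of a proper interval graph is an ordering $v_1,\dots,v_n$ having a proper interval representation $\{[a_i,b_i]\}$ with $a_i\ne b_j$ for all $i,j$, $a_1<\dots<a_n$, $b_1<\dots<b_n$; the vertex canonical sequence lists the $2n$ endpoints in increasing order with $a_i,b_i$ replaced by $v_i$ (here by the block $B_i$).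 A block is a block-neighbor of $w$ if some vertex in it is adjacent to $w$. A block substring is a contiguous stretch of the sequence; it is a perfect block substring of $w$ if all its entries are block-neighbors of $w$ and it contains every block-neighbor of $w$.
   Formalization: The endpoints of the intervals $I_x=[\ell_x,r_x]$ and of the canonical representation $\{[a_i,b_i]\}$ of the blocks are rational. -}

module Defs where

open import Data.Nat using (ℕ; zero; suc; _+_; _∸_) renaming (_≤_ to _≤ℕ_; _<_ to _<ℕ_)
open import Data.Fin using (Fin; toℕ) renaming (_<_ to _<F_)
open import Data.Bool using (Bool; true; false)
open import Data.Rational using (ℚ; _≤_; _<_)
open import Data.List using (List; []; _∷_; _++_; length; tabulate)
open import Data.List.Relation.Unary.All using (All)
open import Data.List.Membership.Propositional using (_∈_)
open import Data.Product using (Σ; ∃; ∃-syntax; _×_; _,_; proj₁)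
open import Data.Sum using (_⊎_)
open import Relation.Nullary using (¬_)
open import Relation.Binary.PropositionalEquality using (_≡_; _≢_)
open import Function.Bundles using (_⇔_)

record Graph (n : ℕ) : Set₁ where
  field
    E     : Fin n → Fin n → Set
    sym   : ∀ {x y} → E x y → E y x
    irrefl : ∀ {x} → ¬ E x x
    isP   : Fin n → Bool

module _ {n : ℕ} (G : Graph n) where
  open Graph G

  Probe : Fin n → Set
  Probe x = isP x ≡ true

  NonProbe : Fin n → Set
  NonProbe x = isP x ≡ false

  data ReachP : Fin n → Fin n → Set where
    here : ∀ {x} → Probe x → ReachP x x
    step : ∀ {x y z} → Probe x → E x y → ReachP y z → ReachP x z

  ConnectedP : Set
  ConnectedP = ∀ x y → Probe x → Probe y → ReachP x y

  InClosedNbhdP : Fin n → Fin n → Set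
  InClosedNbhdP x z = Probe z × (z ≡ x ⊎ E x z)

  SameClosedNbhdP : Fin n → Fin n → Set
  SameClosedNbhdP x y = ∀ z → InClosedNbhdP x z ⇔ InClosedNbhdP y z

Intersect : ℚ → ℚ → ℚ → ℚ → Set
Intersect l₁ r₁ l₂ r₂ = l₁ ≤ r₂ × l₂ ≤ r₁

InInterval : ℚ → ℚ → ℚ → Set
InInterval p l r = l ≤ p × p ≤ r

Subinterval : ℚ → ℚ → ℚ → ℚ → Set
Subinterval l₁ r₁ l₂ r₂ = l₂ ≤ l₁ × r₁ ≤ r₂

ProperSubinterval : ℚ → ℚ → ℚ → ℚ → Set
ProperSubinterval l₁ r₁ l₂ r₂ =
  Subinterval l₁ r₁ l₂ r₂ × ¬ (l₁ ≡ l₂ × r₁ ≡ r₂)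

record IsPTPIGRep {n : ℕ} (G : Graph n) (ℓ r : Fin n → ℚ) : Set where
  open Graph G
  field
    closed      : ∀ x → ℓ x ≤ r x
    N-indep     : ∀ x y → NonProbe G x → NonProbe G y → ¬ E x y
    PP-edge     : ∀ x y → Probe G x → Probe G y → x ≢ y →
                  E x y ⇔ Intersect (ℓ x) (r x) (ℓ y) (r y)
    PN-edge     : ∀ x y → Probe G x → NonProbe G y →
                  E x y ⇔ (InInterval (ℓ x) (ℓ y) (r y) ⊎ InInterval (r x) (ℓ y) (r y))
    P-proper    : ∀ x y → Probe G x → Probe G y →
                  ¬ ProperSubinterval (ℓ x) (r x) (ℓ y) (r y)

IsPTPIG : {n : ℕ} → Graph n → Set
IsPTPIG G = ∃[ ℓ ] ∃[ r ] IsPTPIGRep G ℓ r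

-- Blocks of G_P, indexed by Fin t: blk x is the block of the probe x
-- (blk is irrelevant on nonprobes).  Block i is B_(i+1) in the paper.

record IsBlockMap {n : ℕ} (G : Graph n) (t : ℕ) (blk : Fin n → Fin t) : Set where
  field
    same-block : ∀ x y → Probe G x → Probe G y →
                 blk x ≡ blk y ⇔ SameClosedNbhdP G x y
    onto       : ∀ i → ∃[ x ] (Probe G x × blk x ≡ i)

module _ {n : ℕ} (G : Graph n) {t : ℕ} (blk : Fin n → Fin t) where
  open Graph G

  ReducedAdj : Fin t → Fin t → Set
  ReducedAdj i j = ∃[ x ] ∃[ y ] (Probe G x × Probe G y × blk x ≡ i × blk y ≡ j × E x y)

  BlockNeighbor : Fin n → Fin t → Set
  BlockNeighbor w i = ∃[ x ] (Probe G x × blk x ≡ i × E x w)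

-- Canonical ordering of the reduced graph: intervals [a i , b i] for the
-- blocks in the order given by Fin t.

record IsCanonicalRep {n : ℕ} (G : Graph n) {t : ℕ} (blk : Fin n → Fin t)
                      (a b : Fin t → ℚ) : Set where
  field
    closed    : ∀ i → a i ≤ b i
    adj       : ∀ i j → i ≢ j → ReducedAdj G blk i j ⇔ Intersect (a i) (b i) (a j) (b j)
    proper    : ∀ i j → ¬ ProperSubinterval (a i) (b i) (a j) (b j)
    distinct  : ∀ i j → a i ≢ b j
    a-incr    : ∀ i j → i <F j → a i < a j
    b-incr    : ∀ i j → i <F j → b i < b j

endpoint : {t : ℕ} → (Fin t → ℚ) → (Fin t → ℚ) → Fin t × Bool → ℚ
endpoint a b (i , false) = a i
endpoint a b (i , true)  = b i

-- V is the vertex canonical sequence of the representation (a, b):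
-- the 2t endpoints listed in increasing order, each replaced by its block.
IsVertexCanonicalSeq : {t : ℕ} → (Fin t → ℚ) → (Fin t → ℚ) → List (Fin t) → Set
IsVertexCanonicalSeq {t} a b V =
  Σ (Fin (t + t) → Fin t × Bool) λ e → ( (∀ q → ∃[ k ] (e k ≡ q))
         × (∀ k k′ → k <F k′ → endpoint a b (e k) < endpoint a b (e k′))
         × V ≡ tabulate {n = t + t} (λ k → proj₁ (e k)) )

-- Block substrings of V: an occurrence V = pre ++ mid ++ suf.
-- It occupies the positions [length pre , length pre + length mid).

record BlockSubstring {A : Set} (V : List A) : Set where
  constructor substr
  field
    pre mid suf : List A
    split       : V ≡ pre ++ (mid ++ suf)

OccupiesPos : {A : Set} {V : List A} → BlockSubstring V → ℕ → Set
OccupiesPos T p =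
  length (BlockSubstring.pre T) ≤ℕ p ×
  p <ℕ length (BlockSubstring.pre T) + length (BlockSubstring.mid T)

IntersectExactlyOnce : {A : Set} {V : List A} → BlockSubstring V → BlockSubstring V → Set
IntersectExactlyOnce T₁ T₂ =
  ∃[ p ] (OccupiesPos T₁ p × OccupiesPos T₂ p ×
          (∀ q → OccupiesPos T₁ q → OccupiesPos T₂ q → q ≡ p))

module _ {n : ℕ} (G : Graph n) {t : ℕ} (blk : Fin n → Fin t) where

  IsPerfectFor : {V : List (Fin t)} → Fin n → BlockSubstring V → Set
  IsPerfectFor w T =
    All (BlockNeighbor G blk w) (BlockSubstring.mid T) ×
    (∀ i → BlockNeighbor G blk w i → i ∈ BlockSubstring.mid T)

-- Let x be the block at the common position p and y ≠ x another block-neighbour of w.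
-- The block y occurs in both substrings but not at p, so its two occurrences a_y and b_y
-- lie on either side of p: every block-neighbour's interval contains the endpoint at p,
-- and the block-neighbours form a clique.  A block-neighbour whose two endpoints both lie
-- in T₁ ∪ T₂ meets only block-neighbours (by properness), so its closed neighbourhood is
-- the set of all block-neighbours; two such blocks coincide.  Hence the block-neighbours
-- are exactly x and y, the other endpoint of x lies outside T₁ ∪ T₂, and V reads y x y
-- around p.  If the endpoint at p is a_x, the blocks ending before a_y are closed under
-- meeting, so by connectivity there are none and y x y starts V; symmetrically, if it
-- is b_x, then y x y ends V.  As a and b are increasing, y is then the first (last)
-- block and x its successor (predecessor).
module Submission where

open import Defs
open import Data.Nat using (ℕ; suc; _+_; _∸_; _⊔_; z≤n; s≤s)
  renaming (_≤_ to _≤ℕ_; _<_ to _<ℕ_)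
import Data.Nat.Properties as ℕₚ
open import Data.Fin using (Fin; toℕ; fromℕ; fromℕ<) renaming (zero to fzero; suc to fsuc)
import Data.Fin.Properties as Finₚ
open import Data.Rational using (ℚ; _≤_; _<_)
import Data.Rational.Properties as ℚₚ
open import Data.Bool using (Bool; true; false)
open import Data.List using (List; []; _∷_; _++_; map; length; tabulate)
import Data.List.Properties as Listₚ
open import Data.List.Relation.Unary.All using (All; _∷_)
open import Data.List.Relation.Unary.Any using (here; there)
open import Data.List.Membership.Propositional using (_∈_)
open import Data.Product using (∃-syntax; _×_; _,_; proj₁; proj₂)
open import Data.Sum using (_⊎_; inj₁; inj₂; map₂)
open import Data.Sum.Algebra using (⊎-comm)
open import Data.Empty using (⊥; ⊥-elim)
open import Relation.Nullary using (¬_; yes; no)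
open import Relation.Binary.Definitions using (tri<; tri≈; tri>)
open import Relation.Binary.PropositionalEquality
  using (_≡_; _≢_; refl; sym; trans; cong; cong₂; subst; subst₂)
open import Function.Bundles using (_⇔_; mk⇔; Equivalence)
import Function.Properties.Equivalence as ⇔
open import Function.Properties.Inverse using (↔⇒⇔)

<⇒≱ : ∀ {r r′ : ℚ} → r < r′ → ¬ r′ ≤ r
<⇒≱ r<r′ r′≤r = ℚₚ.<-irrefl refl (ℚₚ.<-≤-trans r<r′ r′≤r)

module _ {m : ℕ} {f : Fin m → ℚ} (f-incr : ∀ i j → toℕ i <ℕ toℕ j → f i < f j) where

  strictMono⇒reflects-< : ∀ {u v} → f u < f v → toℕ u <ℕ toℕ v
  strictMono⇒reflects-< {u} {v} fu<fv with ℕₚ.<-cmp (toℕ u) (toℕ v)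
  ... | tri< u<v _ _ = u<v
  ... | tri≈ _ u≡v _ = ⊥-elim (ℚₚ.<-irrefl (cong f (Finₚ.toℕ-injective u≡v)) fu<fv)
  ... | tri> _ _ v<u = ⊥-elim (ℚₚ.<-asym fu<fv (f-incr v u v<u))

  strictMono⇒injective : ∀ {u v} → f u ≡ f v → u ≡ v
  strictMono⇒injective {u} {v} fu≡fv with ℕₚ.<-cmp (toℕ u) (toℕ v)
  ... | tri< u<v _ _ = ⊥-elim (ℚₚ.<-irrefl fu≡fv (f-incr u v u<v))
  ... | tri≈ _ u≡v _ = Finₚ.toℕ-injective u≡v
  ... | tri> _ _ v<u = ⊥-elim (ℚₚ.<-irrefl (sym fu≡fv) (f-incr v u v<u))

infix 4 _[_]=_

data _[_]=_ {A : Set} : List A → ℕ → A → Set where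
  here  : ∀ {x xs} → x ∷ xs [ 0 ]= x
  there : ∀ {x xs k y} → xs [ k ]= y → x ∷ xs [ suc k ]= y

module _ {A : Set} where

  []=-tabulate⁺ : ∀ {m} (f : Fin m → A) (k : Fin m) → tabulate f [ toℕ k ]= f k
  []=-tabulate⁺ f fzero    = here
  []=-tabulate⁺ f (fsuc k) = there ([]=-tabulate⁺ (λ z → f (fsuc z)) k)

  []=-tabulate⁻ : ∀ {m} (f : Fin m → A) {j y} → tabulate f [ j ]= y →
                  ∃[ k ] (toℕ k ≡ j × f k ≡ y)
  []=-tabulate⁻ {suc m} f here = fzero , refl , refl
  []=-tabulate⁻ {suc m} f (there p) with []=-tabulate⁻ (λ z → f (fsuc z)) p
  ... | k , refl , fk≡y = fsuc k , refl , fk≡y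

  []=-++⁺ˡ : ∀ {L R : List A} {j x} → L [ j ]= x → L ++ R [ j ]= x
  []=-++⁺ˡ here      = here
  []=-++⁺ˡ (there p) = there ([]=-++⁺ˡ p)

  []=-++⁺ʳ : ∀ (pre : List A) {L j x} → L [ j ]= x → pre ++ L [ length pre + j ]= x
  []=-++⁺ʳ []        p = p
  []=-++⁺ʳ (_ ∷ pre) p = there ([]=-++⁺ʳ pre p)

  []=-++⁻ˡ : ∀ (L : List A) {R j x} → L ++ R [ j ]= x → j <ℕ length L → L [ j ]= x
  []=-++⁻ˡ (_ ∷ L) here      _        = here
  []=-++⁻ˡ (_ ∷ L) (there p) (s≤s lt) = there ([]=-++⁻ˡ L p lt)

  []=-++⁻ʳ : ∀ (pre : List A) {L j x} → pre ++ L [ length pre + j ]= x → L [ j ]= x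
  []=-++⁻ʳ []        p         = p
  []=-++⁻ʳ (_ ∷ pre) (there p) = []=-++⁻ʳ pre p

  ∈⇒[]= : ∀ {L : List A} {x} → x ∈ L → ∃[ j ] (L [ j ]= x)
  ∈⇒[]= (here refl) = 0 , here
  ∈⇒[]= (there p)   = let j , q = ∈⇒[]= p in suc j , there q

  []=⇒<length : ∀ {L : List A} {j x} → L [ j ]= x → j <ℕ length L
  []=⇒<length here      = s≤s z≤n
  []=⇒<length (there p) = s≤s ([]=⇒<length p)

  All-[]= : ∀ {P : A → Set} {L j x} → All P L → L [ j ]= x → P x
  All-[]= (px ∷ _)  here      = px
  All-[]= (_  ∷ ps) (there q) = All-[]= ps q

  []=-prefix : ∀ {L : List A} {x y z} → L [ 0 ]= x → L [ 1 ]= y → L [ 2 ]= z →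
               ∃[ rest ] (L ≡ x ∷ y ∷ z ∷ rest)
  []=-prefix here (there here) (there (there here)) = _ , refl

  []=-suffix : ∀ {L : List A} {k x y z} →
               L [ k ]= x → L [ suc k ]= y → L [ suc (suc k) ]= z →
               length L ≡ suc (suc (suc k)) → ∃[ pre ] (L ≡ pre ++ x ∷ y ∷ z ∷ [])
  []=-suffix {_ ∷ _ ∷ _ ∷ []} here (there here) (there (there here)) refl = [] , refl
  []=-suffix {w ∷ L} (there p) (there q) (there r) eq =
    let pre , L≡ = []=-suffix p q r (ℕₚ.suc-injective eq) in w ∷ pre , cong (w ∷_) L≡

toℕ-least : ∀ {t} (y : Fin t) → (∀ (z : Fin t) → toℕ y ≤ℕ toℕ z) → toℕ y ≡ 0
toℕ-least {suc t} y least = ℕₚ.n≤0⇒n≡0 (least fzero)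

toℕ-greatest : ∀ {t} (y : Fin t) → (∀ (z : Fin t) → toℕ z ≤ℕ toℕ y) → toℕ y ≡ t ∸ 1
toℕ-greatest {suc t} y greatest =
  ℕₚ.≤-antisym (ℕₚ.≤-pred (Finₚ.toℕ<n y))
               (subst (_≤ℕ toℕ y) (Finₚ.toℕ-fromℕ t) (greatest (fromℕ t)))

toℕ-successor : ∀ {t} (u v : Fin t) → toℕ u <ℕ toℕ v →
                (∀ (z : Fin t) → toℕ u <ℕ toℕ z → toℕ z <ℕ toℕ v → ⊥) → suc (toℕ u) ≡ toℕ v
toℕ-successor {t} u v u<v nothing-between with ℕₚ.m≤n⇒m<n∨m≡n u<v
... | inj₂ eq = eq
... | inj₁ 1+u<v = ⊥-elim (nothing-between z (subst (toℕ u <ℕ_) (sym z≡) (ℕₚ.n<1+n _))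
                                              (subst (_<ℕ toℕ v) (sym z≡) 1+u<v))
  where
  1+u<t : suc (toℕ u) <ℕ t
  1+u<t = ℕₚ.<-trans 1+u<v (Finₚ.toℕ<n v)
  z : Fin t
  z = fromℕ< 1+u<t
  z≡ : toℕ z ≡ suc (toℕ u)
  z≡ = Finₚ.toℕ-fromℕ< 1+u<t

module ReducedGraph {n : ℕ} (G : Graph n) {t : ℕ} {blk : Fin n → Fin t} (bm : IsBlockMap G t blk)
                    {a b : Fin t → ℚ} (cr : IsCanonicalRep G blk a b) where
  open Graph G using (E) renaming (sym to E-sym)
  open IsBlockMap bm
  open IsCanonicalRep cr

  Meet : Fin t → Fin t → Set
  Meet i j = Intersect (a i) (b i) (a j) (b j)

  Meet-refl : ∀ i → Meet i i
  Meet-refl i = closed i , closed i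

  same-block⇒⊆closedNbhd : ∀ {u v} → Probe G u → Probe G v → blk u ≡ blk v →
                           ∀ z → InClosedNbhdP G u z → InClosedNbhdP G v z
  same-block⇒⊆closedNbhd {u} {v} pu pv eq z = Equivalence.to (Equivalence.to (same-block u v pu pv) eq z)

  same-block⇒adjacent : ∀ {u v} → Probe G u → Probe G v → u ≢ v → blk u ≡ blk v → E u v
  same-block⇒adjacent {u} pu pv u≢v eq
    with proj₂ (same-block⇒⊆closedNbhd pu pv eq u (pu , inj₁ refl))
  ... | inj₁ u≡v = ⊥-elim (u≢v u≡v)
  ... | inj₂ E-vu = E-sym E-vu

  adjacent⇒Meet : ∀ {u v} → Probe G u → Probe G v → E u v → Meet (blk u) (blk v)
  adjacent⇒Meet {u} {v} pu pv E-uv with blk u Finₚ.≟ blk v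
  ... | yes eq rewrite eq = Meet-refl (blk v)
  ... | no ne = Equivalence.to (adj (blk u) (blk v) ne) (u , v , pu , pv , refl , refl , E-uv)

  Meet⇒adjacent : ∀ {u v} → Probe G u → Probe G v → u ≢ v → Meet (blk u) (blk v) → E u v
  Meet⇒adjacent {u} {v} pu pv u≢v M with blk u Finₚ.≟ blk v
  ... | yes eq = same-block⇒adjacent pu pv u≢v eq
  ... | no ne with Equivalence.from (adj (blk u) (blk v) ne) M
  ... | u′ , v′ , pu′ , pv′ , u′∈bu , v′∈bv , E-u′v′
    with proj₂ (same-block⇒⊆closedNbhd pu′ pu u′∈bu v′ (pv′ , inj₂ E-u′v′))
  ... | inj₁ v′≡u = ⊥-elim (ne (trans (cong blk (sym v′≡u)) v′∈bv))
  ... | inj₂ E-uv′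
    with proj₂ (same-block⇒⊆closedNbhd pv′ pv v′∈bv u (pu , inj₂ (E-sym E-uv′)))
  ... | inj₁ u≡v = ⊥-elim (u≢v u≡v)
  ... | inj₂ E-vu = E-sym E-vu

  closedNbhd⇔Meet : ∀ {u} → Probe G u →
                    ∀ z → InClosedNbhdP G u z ⇔ (Probe G z × Meet (blk u) (blk z))
  closedNbhd⇔Meet {u} pu z = mk⇔ to from
    where
    to : InClosedNbhdP G u z → Probe G z × Meet (blk u) (blk z)
    to (pz , inj₁ refl) = pz , Meet-refl (blk u)
    to (pz , inj₂ E-uz) = pz , adjacent⇒Meet pu pz E-uz
    from : Probe G z × Meet (blk u) (blk z) → InClosedNbhdP G u z
    from (pz , M) with z Finₚ.≟ u
    ... | yes z≡u = pz , inj₁ z≡u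
    ... | no z≢u  = pz , inj₂ (Meet⇒adjacent pu pz (λ u≡z → z≢u (sym u≡z)) M)

  same-Meet⇒≡ : ∀ i j → (∀ k → Meet i k → Meet j k) → (∀ k → Meet j k → Meet i k) → i ≡ j
  same-Meet⇒≡ i j i⊆j j⊆i with onto i | onto j
  ... | u , pu , refl | v , pv , refl = Equivalence.from (same-block u v pu pv) same-nbhd
    where
    same-nbhd : SameClosedNbhdP G u v
    same-nbhd z = mk⇔
      (λ h → let pz , M = Equivalence.to (closedNbhd⇔Meet pu z) h in
             Equivalence.from (closedNbhd⇔Meet pv z) (pz , i⊆j (blk z) M))
      (λ h → let pz , M = Equivalence.to (closedNbhd⇔Meet pv z) h in
             Equivalence.from (closedNbhd⇔Meet pu z) (pz , j⊆i (blk z) M))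

  Meet-closed : (Fin t → Set) → Set
  Meet-closed L = ∀ i j → L i → Meet i j → L j

  Meet-closed-universal : ConnectedP G → ∀ L → Meet-closed L → ∀ i j → L i → L j
  Meet-closed-universal conn L closure i j Li with onto i | onto j
  ... | u , pu , refl | v , pv , refl = along (conn u v pu pv) Li
    where
    probe-start : ∀ {x z} → ReachP G x z → Probe G x
    probe-start (here px)     = px
    probe-start (step px _ _) = px
    along : ∀ {x z} → ReachP G x z → L (blk x) → L (blk z)
    along (here _) Lx = Lx
    along (step {x} {y} px E-xy r) Lx =
      along r (closure (blk x) (blk y) Lx (adjacent⇒Meet px (probe-start r) E-xy))

  a<b : ∀ i → a i < b i
  a<b i with ℚₚ.<-cmp (a i) (b i)
  ... | tri< lt _ _ = lt
  ... | tri≈ _ eq _ = ⊥-elim (distinct i i eq)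
  ... | tri> _ _ gt = ⊥-elim (ℚₚ.<-irrefl refl (ℚₚ.<-≤-trans gt (closed i)))

  no-nesting : ∀ i z → a z < a i → b i < b z → ⊥
  no-nesting i z az<ai bi<bz =
    proper i z ((ℚₚ.<⇒≤ az<ai , ℚₚ.<⇒≤ bi<bz) , λ (ai≡az , _) → ℚₚ.<-irrefl (sym ai≡az) az<ai)

module SortedEndpoints {t : ℕ} {a b : Fin t → ℚ} (a<b : ∀ i → a i < b i)
                       (e : Fin (t + t) → Fin t × Bool) (e-onto : ∀ q → ∃[ k ] (e k ≡ q))
                       (e-sorted : ∀ k k′ → toℕ k <ℕ toℕ k′ → endpoint a b (e k) < endpoint a b (e k′))
                       where

  val : Fin (t + t) → ℚ
  val k = endpoint a b (e k)

  block : Fin (t + t) → Fin t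
  block k = proj₁ (e k)

  earlier⇒< : ∀ {k k′ r r′} → val k ≡ r → val k′ ≡ r′ → toℕ k <ℕ toℕ k′ → r < r′
  earlier⇒< {k} {k′} refl refl k<k′ = e-sorted k k′ k<k′

  <⇒earlier : ∀ {k k′ r r′} → val k ≡ r → val k′ ≡ r′ → r < r′ → toℕ k <ℕ toℕ k′
  <⇒earlier refl refl = strictMono⇒reflects-< e-sorted

  e-injective : ∀ {k k′} → e k ≡ e k′ → k ≡ k′
  e-injective eq = strictMono⇒injective e-sorted (cong (endpoint a b) eq)

  posA posB : Fin t → Fin (t + t)
  posA i = proj₁ (e-onto (i , false))
  posB i = proj₁ (e-onto (i , true))

  e-posA : ∀ i → e (posA i) ≡ (i , false)
  e-posA i = proj₂ (e-onto _)

  e-posB : ∀ i → e (posB i) ≡ (i , true)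
  e-posB i = proj₂ (e-onto _)

  val-posA : ∀ i → val (posA i) ≡ a i
  val-posA i = cong (endpoint a b) (e-posA i)

  val-posB : ∀ i → val (posB i) ≡ b i
  val-posB i = cong (endpoint a b) (e-posB i)

  block-posA : ∀ i → block (posA i) ≡ i
  block-posA i = cong proj₁ (e-posA i)

  block-posB : ∀ i → block (posB i) ≡ i
  block-posB i = cong proj₁ (e-posB i)

  posA<posB : ∀ i → toℕ (posA i) <ℕ toℕ (posB i)
  posA<posB i = <⇒earlier (val-posA i) (val-posB i) (a<b i)

  posA-or-posB : ∀ k → k ≡ posA (block k) ⊎ k ≡ posB (block k)
  posA-or-posB k with e k in ek
  ... | i , false = inj₁ (e-injective (trans ek (sym (e-posA i))))
  ... | i , true  = inj₂ (e-injective (trans ek (sym (e-posB i))))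

  posA≢posB : ∀ {i j} → posA i ≢ posB j
  posA≢posB {i} {j} eq with trans (sym (e-posA i)) (trans (cong e eq) (e-posB j))
  ... | ()

  posA-injective : ∀ {i j} → posA i ≡ posA j → i ≡ j
  posA-injective {i} {j} eq = cong proj₁ (trans (sym (e-posA i)) (trans (cong e eq) (e-posA j)))

  posB-injective : ∀ {i j} → posB i ≡ posB j → i ≡ j
  posB-injective {i} {j} eq = cong proj₁ (trans (sym (e-posB i)) (trans (cong e eq) (e-posB j)))

  val-within : ∀ k → a (block k) ≤ val k × val k ≤ b (block k)
  val-within k with e k
  ... | i , false = ℚₚ.≤-refl , ℚₚ.<⇒≤ (a<b i)
  ... | i , true  = ℚₚ.<⇒≤ (a<b i) , ℚₚ.≤-refl

  occurrence : ∀ {k y} → block k ≡ y → k ≡ posA y ⊎ k ≡ posB y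
  occurrence {k} refl = posA-or-posB k

  occurrences : ∀ {k k′ y} → toℕ k <ℕ toℕ k′ → block k ≡ y → block k′ ≡ y →
                k ≡ posA y × k′ ≡ posB y
  occurrences {y = y} k<k′ k∈y k′∈y with occurrence k∈y | occurrence k′∈y
  ... | inj₁ refl | inj₁ refl = ⊥-elim (ℕₚ.<-irrefl refl k<k′)
  ... | inj₁ refl | inj₂ refl = refl , refl
  ... | inj₂ refl | inj₁ refl = ⊥-elim (ℕₚ.<-asym k<k′ (posA<posB y))
  ... | inj₂ refl | inj₂ refl = ⊥-elim (ℕₚ.<-irrefl refl k<k′)

module TabulatedSubstrings {A : Set} {m : ℕ} (f : Fin m → A) {V : List A} (V≡ : V ≡ tabulate f) where

  length-V : length V ≡ m
  length-V = trans (cong length V≡) (Listₚ.length-tabulate f)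

  V[]-≡ : ∀ k {j y} → toℕ k ≡ j → f k ≡ y → V [ j ]= y
  V[]-≡ k refl refl = subst (λ L → L [ toℕ k ]= f k) (sym V≡) ([]=-tabulate⁺ f k)

  ∈-mid⇒occupied : ∀ (T : BlockSubstring V) {i} → i ∈ BlockSubstring.mid T →
                   ∃[ k ] (OccupiesPos T (toℕ k) × f k ≡ i)
  ∈-mid⇒occupied (substr pre mid suf split) i∈mid with ∈⇒[]= i∈mid
  ... | j , mid[j] with []=-tabulate⁻ f (subst (_[ length pre + j ]= _) (trans (sym split) V≡)
                                                 ([]=-++⁺ʳ pre ([]=-++⁺ˡ {R = suf} mid[j])))
  ... | k , k≡ , fk≡i = k , subst (OccupiesPos (substr pre mid suf split)) (sym k≡)
                               (ℕₚ.m≤m+n _ _ , ℕₚ.+-monoʳ-< (length pre) ([]=⇒<length mid[j])) , fk≡i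

  All-mid⇒occupied : ∀ (T : BlockSubstring V) {P : A → Set} → All P (BlockSubstring.mid T) →
                     ∀ k → OccupiesPos T (toℕ k) → P (f k)
  All-mid⇒occupied (substr pre mid suf split) all-mid k (pre≤k , k<end) = All-[]= all-mid mid[j]
    where
    j = toℕ k ∸ length pre
    k≡ : length pre + j ≡ toℕ k
    k≡ = ℕₚ.m+[n∸m]≡n pre≤k
    mid[j] : mid [ j ]= f k
    mid[j] = []=-++⁻ˡ mid
               ([]=-++⁻ʳ pre (subst (_[ length pre + j ]= f k) split (V[]-≡ k (sym k≡) refl)))
               (ℕₚ.+-cancelˡ-< (length pre) _ _ (subst (_<ℕ length pre + length mid) (sym k≡) k<end))

  occupied⇒position : ∀ (T : BlockSubstring V) {q} → OccupiesPos T q → ∃[ k ] (toℕ k ≡ q)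
  occupied⇒position (substr pre mid suf split) {q} (_ , q<end) = fromℕ< q<m , Finₚ.toℕ-fromℕ< q<m
    where
    length-split : length V ≡ length pre + (length mid + length suf)
    length-split = trans (cong length split)
                         (trans (Listₚ.length-++ pre) (cong (length pre +_) (Listₚ.length-++ mid)))
    q<m : q <ℕ m
    q<m = subst (q <ℕ_) (trans (sym length-split) length-V)
                (ℕₚ.<-≤-trans q<end (ℕₚ.+-monoʳ-≤ (length pre) (ℕₚ.m≤m+n (length mid) (length suf))))

module TwoPerfectSubstrings
  {n : ℕ} {G : Graph n} (conn : ConnectedP G)
  {t : ℕ} {blk : Fin n → Fin t} (bm : IsBlockMap G t blk)
  {a b : Fin t → ℚ} (cr : IsCanonicalRep G blk a b)
  (e : Fin (t + t) → Fin t × Bool) (e-onto : ∀ q → ∃[ k ] (e k ≡ q))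
  (e-sorted : ∀ k k′ → toℕ k <ℕ toℕ k′ → endpoint a b (e k) < endpoint a b (e k′))
  {V : List (Fin t)} (V≡ : V ≡ tabulate (λ k → proj₁ (e k)))
  (w : Fin n) (T₁ T₂ : BlockSubstring V)
  (perfect₁ : IsPerfectFor G blk w T₁) (perfect₂ : IsPerfectFor G blk w T₂)
  {p : ℕ} (p∈T₁ : OccupiesPos T₁ p) (p∈T₂ : OccupiesPos T₂ p)
  (only-p : ∀ q → OccupiesPos T₁ q → OccupiesPos T₂ q → q ≡ p)
  (T₁-starts-first : length (BlockSubstring.pre T₁) ≤ℕ length (BlockSubstring.pre T₂))
  where

  open IsCanonicalRep cr using (a-incr; b-incr)
  open ReducedGraph G bm cr
  open SortedEndpoints a<b e e-onto e-sorted
  open TabulatedSubstrings block V≡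

  Nbr : Fin t → Set
  Nbr = BlockNeighbor G blk w

  s₁ s₂ f₁ f₂ hi : ℕ
  s₁ = length (BlockSubstring.pre T₁)
  s₂ = length (BlockSubstring.pre T₂)
  f₁ = s₁ + length (BlockSubstring.mid T₁)
  f₂ = s₂ + length (BlockSubstring.mid T₂)
  hi = f₁ ⊔ f₂

  InUnion : ℕ → Set
  InUnion q = s₁ ≤ℕ q × q <ℕ hi

  data Region (q : ℕ) : Set where
    before : q <ℕ s₁ → Region q
    inside : InUnion q → Region q
    after  : hi ≤ℕ q → Region q

  region : ∀ q → Region q
  region q with q ℕₚ.<? s₁ | q ℕₚ.<? hi
  ... | yes q<s₁ | _       = before q<s₁
  ... | no  q≮s₁ | yes q<hi = inside (ℕₚ.≮⇒≥ q≮s₁ , q<hi)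
  ... | no  _    | no  q≮hi = after (ℕₚ.≮⇒≥ q≮hi)

  pF : Fin (t + t)
  pF = proj₁ (occupied⇒position T₁ p∈T₁)

  pF≡p : toℕ pF ≡ p
  pF≡p = proj₂ (occupied⇒position T₁ p∈T₁)

  x : Fin t
  x = block pF

  InUnion⇒Nbr : ∀ k → InUnion (toℕ k) → Nbr (block k)
  InUnion⇒Nbr k (s₁≤k , k<hi) with toℕ k ℕₚ.<? f₁
  ... | yes k<f₁ = All-mid⇒occupied T₁ (proj₁ perfect₁) k (s₁≤k , k<f₁)
  ... | no  k≮f₁ = All-mid⇒occupied T₂ (proj₁ perfect₂) k (s₂≤k , k<f₂)
    where
    f₁≤k : f₁ ≤ℕ toℕ k
    f₁≤k = ℕₚ.≮⇒≥ k≮f₁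
    s₂≤k : s₂ ≤ℕ toℕ k
    s₂≤k = ℕₚ.≤-trans (proj₁ p∈T₂) (ℕₚ.≤-trans (ℕₚ.<⇒≤ (proj₂ p∈T₁)) f₁≤k)
    k<f₂ : toℕ k <ℕ f₂
    k<f₂ with ℕₚ.≤-total f₁ f₂
    ... | inj₁ f₁≤f₂ = subst (toℕ k <ℕ_) (ℕₚ.m≤n⇒m⊔n≡n f₁≤f₂) k<hi
    ... | inj₂ f₂≤f₁ = ⊥-elim (k≮f₁ (subst (toℕ k <ℕ_) (ℕₚ.m≥n⇒m⊔n≡m f₂≤f₁) k<hi))

  pF-InUnion : InUnion (toℕ pF)
  pF-InUnion = subst InUnion (sym pF≡p) (proj₁ p∈T₁ , ℕₚ.<-≤-trans (proj₂ p∈T₁) (ℕₚ.m≤m⊔n f₁ f₂))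

  Nbr-x : Nbr x
  Nbr-x = InUnion⇒Nbr pF pF-InUnion

  Straddles : Fin t → Set
  Straddles y = toℕ (posA y) <ℕ p × p <ℕ toℕ (posB y)

  InsideUnion : Fin t → Set
  InsideUnion y = s₁ ≤ℕ toℕ (posA y) × toℕ (posB y) <ℕ hi

  -- A neighbour y ≠ x occurs in both substrings but not at their common position,
  -- so once in T₁ before p and once in T₂ after p: these are a_y and b_y.
  Nbr-straddles : ∀ y → Nbr y → y ≢ x → Straddles y × InsideUnion y
  Nbr-straddles y Nbr-y y≢x
    with ∈-mid⇒occupied T₁ (proj₂ perfect₁ y Nbr-y) | ∈-mid⇒occupied T₂ (proj₂ perfect₂ y Nbr-y)
  ... | k₁ , k₁∈T₁ , k₁∈y | k₂ , k₂∈T₂ , k₂∈y =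
    (subst (λ k → toℕ k <ℕ p) k₁≡ k₁<p , subst (λ k → p <ℕ toℕ k) k₂≡ p<k₂) ,
    (subst (λ k → s₁ ≤ℕ toℕ k) k₁≡ (proj₁ k₁∈T₁) ,
     subst (λ k → toℕ k <ℕ hi) k₂≡ (ℕₚ.<-≤-trans (proj₂ k₂∈T₂) (ℕₚ.m≤n⊔m f₁ f₂)))
    where
    not-p : ∀ {k} → block k ≡ y → toℕ k ≢ p
    not-p {k} k∈y k≡p =
      y≢x (trans (sym k∈y) (cong block (Finₚ.toℕ-injective (trans k≡p (sym pF≡p)))))
    f₁≤k₂ : f₁ ≤ℕ toℕ k₂
    f₁≤k₂ = ℕₚ.≮⇒≥ (λ k₂<f₁ →
              not-p k₂∈y (only-p _ (ℕₚ.≤-trans T₁-starts-first (proj₁ k₂∈T₂) , k₂<f₁) k₂∈T₂))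
    p<k₂ : p <ℕ toℕ k₂
    p<k₂ = ℕₚ.<-≤-trans (proj₂ p∈T₁) f₁≤k₂
    k₁<p : toℕ k₁ <ℕ p
    k₁<p with s₂ ℕₚ.≤? toℕ k₁
    ... | no  k₁≱s₂ = ℕₚ.<-≤-trans (ℕₚ.≰⇒> k₁≱s₂) (proj₁ p∈T₂)
    ... | yes s₂≤k₁ = ⊥-elim (not-p k₁∈y (only-p _ k₁∈T₁ (s₂≤k₁ , k₁<f₂)))
      where
      k₁<f₂ : toℕ k₁ <ℕ f₂
      k₁<f₂ = ℕₚ.<-≤-trans (proj₂ k₁∈T₁) (ℕₚ.≤-trans f₁≤k₂ (ℕₚ.<⇒≤ (proj₂ k₂∈T₂)))
    k₁≡ : k₁ ≡ posA y
    k₁≡ = proj₁ (occurrences (ℕₚ.<-trans k₁<p p<k₂) k₁∈y k₂∈y)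
    k₂≡ : k₂ ≡ posB y
    k₂≡ = proj₂ (occurrences (ℕₚ.<-trans k₁<p p<k₂) k₁∈y k₂∈y)

  Nbr-contains-p : ∀ u → Nbr u → a u ≤ val pF × val pF ≤ b u
  Nbr-contains-p u Nbr-u with u Finₚ.≟ x
  ... | yes refl = val-within pF
  ... | no  u≢x  =
    let (posA<p , p<posB) , _ = Nbr-straddles u Nbr-u u≢x in
    ℚₚ.<⇒≤ (earlier⇒< (val-posA u) refl (subst (toℕ (posA u) <ℕ_) (sym pF≡p) posA<p)) ,
    ℚₚ.<⇒≤ (earlier⇒< refl (val-posB u) (subst (_<ℕ toℕ (posB u)) (sym pF≡p) p<posB))

  Nbr-clique : ∀ u v → Nbr u → Nbr v → Meet u v
  Nbr-clique u v Nbr-u Nbr-v =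
    ℚₚ.≤-trans (proj₁ (Nbr-contains-p u Nbr-u)) (proj₂ (Nbr-contains-p v Nbr-v)) ,
    ℚₚ.≤-trans (proj₁ (Nbr-contains-p v Nbr-v)) (proj₂ (Nbr-contains-p u Nbr-u))

  InsideUnion-Meet⇒Nbr : ∀ i → InsideUnion i → ∀ z → Meet i z → Nbr z
  InsideUnion-Meet⇒Nbr i (s₁≤ai , bi<hi) z (ai≤bz , az≤bi)
    with region (toℕ (posA z)) | region (toℕ (posB z))
  ... | inside az∈ | _ = subst Nbr (block-posA z) (InUnion⇒Nbr (posA z) az∈)
  ... | before _   | inside bz∈ = subst Nbr (block-posB z) (InUnion⇒Nbr (posB z) bz∈)
  ... | after hi≤az | _ =
    ⊥-elim (<⇒≱ (earlier⇒< (val-posB i) (val-posA z) (ℕₚ.<-≤-trans bi<hi hi≤az)) az≤bi)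
  ... | before _ | before bz<s₁ =
    ⊥-elim (<⇒≱ (earlier⇒< (val-posB z) (val-posA i) (ℕₚ.<-≤-trans bz<s₁ s₁≤ai)) ai≤bz)
  ... | before az<s₁ | after hi≤bz =
    ⊥-elim (no-nesting i z (earlier⇒< (val-posA z) (val-posA i) (ℕₚ.<-≤-trans az<s₁ s₁≤ai))
                           (earlier⇒< (val-posB i) (val-posB z) (ℕₚ.<-≤-trans bi<hi hi≤bz)))

  -- Both closed neighbourhoods are exactly the neighbours of w.
  InsideUnion-Nbr-unique : ∀ i j → Nbr i → Nbr j → InsideUnion i → InsideUnion j → i ≡ j
  InsideUnion-Nbr-unique i j Nbr-i Nbr-j i-in j-in =
    same-Meet⇒≡ i j (λ k M → Nbr-clique j k Nbr-j (InsideUnion-Meet⇒Nbr i i-in k M))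
                    (λ k M → Nbr-clique i k Nbr-i (InsideUnion-Meet⇒Nbr j j-in k M))

  module Pair (y : Fin t) (Nbr-y : Nbr y) (y≢x : y ≢ x) where

    y-straddles : Straddles y
    y-straddles = proj₁ (Nbr-straddles y Nbr-y y≢x)

    y-inside : InsideUnion y
    y-inside = proj₂ (Nbr-straddles y Nbr-y y≢x)

    Nbr⇒x⊎y : ∀ i → Nbr i → i ≡ x ⊎ i ≡ y
    Nbr⇒x⊎y i Nbr-i with i Finₚ.≟ x
    ... | yes i≡x = inj₁ i≡x
    ... | no  i≢x = inj₂ (InsideUnion-Nbr-unique i y Nbr-i Nbr-y
                           (proj₂ (Nbr-straddles i Nbr-i i≢x)) y-inside)

    Nbr⇔x⊎y : ∀ i → Nbr i ⇔ (toℕ i ≡ toℕ x ⊎ toℕ i ≡ toℕ y)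
    Nbr⇔x⊎y i = mk⇔ to from
      where
      to : Nbr i → toℕ i ≡ toℕ x ⊎ toℕ i ≡ toℕ y
      to Nbr-i with Nbr⇒x⊎y i Nbr-i
      ... | inj₁ refl = inj₁ refl
      ... | inj₂ refl = inj₂ refl
      from : toℕ i ≡ toℕ x ⊎ toℕ i ≡ toℕ y → Nbr i
      from (inj₁ i≡x) = subst Nbr (sym (Finₚ.toℕ-injective i≡x)) Nbr-x
      from (inj₂ i≡y) = subst Nbr (sym (Finₚ.toℕ-injective i≡y)) Nbr-y

    x-not-inside : ¬ InsideUnion x
    x-not-inside x-inside = y≢x (InsideUnion-Nbr-unique y x Nbr-y Nbr-x y-inside x-inside)

    x-only-at-p : ∀ k → block k ≡ x → InUnion (toℕ k) → k ≡ pF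
    x-only-at-p k k∈x k∈U with occurrence k∈x | occurrence {pF} refl
    ... | inj₁ k≡ | inj₁ pF≡ = trans k≡ (sym pF≡)
    ... | inj₂ k≡ | inj₂ pF≡ = trans k≡ (sym pF≡)
    ... | inj₁ k≡ | inj₂ pF≡ = ⊥-elim (x-not-inside (subst (λ k → s₁ ≤ℕ toℕ k) k≡ (proj₁ k∈U) ,
                                                      subst (λ k → toℕ k <ℕ hi) pF≡ (proj₂ pF-InUnion)))
    ... | inj₂ k≡ | inj₁ pF≡ = ⊥-elim (x-not-inside (subst (λ k → s₁ ≤ℕ toℕ k) pF≡ (proj₁ pF-InUnion) ,
                                                      subst (λ k → toℕ k <ℕ hi) k≡ (proj₂ k∈U)))

    span-y-InUnion : ∀ q → toℕ (posA y) ≤ℕ q → q ≤ℕ toℕ (posB y) → InUnion q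
    span-y-InUnion q ay≤q q≤by = ℕₚ.≤-trans (proj₁ y-inside) ay≤q , ℕₚ.≤-<-trans q≤by (proj₂ y-inside)

    span-y : ∀ k → toℕ (posA y) ≤ℕ toℕ k → toℕ k ≤ℕ toℕ (posB y) →
             k ≡ posA y ⊎ k ≡ pF ⊎ k ≡ posB y
    span-y k ay≤k k≤by with Nbr⇒x⊎y (block k) (InUnion⇒Nbr k (span-y-InUnion (toℕ k) ay≤k k≤by))
    ... | inj₁ k∈x = inj₂ (inj₁ (x-only-at-p k k∈x (span-y-InUnion (toℕ k) ay≤k k≤by)))
    ... | inj₂ k∈y = map₂ inj₂ (occurrence k∈y)

    span-yℕ : ∀ q → toℕ (posA y) ≤ℕ q → q ≤ℕ toℕ (posB y) →
              q ≡ toℕ (posA y) ⊎ q ≡ p ⊎ q ≡ toℕ (posB y)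
    span-yℕ q ay≤q q≤by with span-y k (subst (_ ≤ℕ_) (sym k≡q) ay≤q) (subst (_≤ℕ _) (sym k≡q) q≤by)
      where
      q<m : q <ℕ t + t
      q<m = ℕₚ.≤-<-trans q≤by (Finₚ.toℕ<n (posB y))
      k = fromℕ< q<m
      k≡q : toℕ k ≡ q
      k≡q = Finₚ.toℕ-fromℕ< q<m
    ... | inj₁ eq          = inj₁ (trans (sym (Finₚ.toℕ-fromℕ< _)) (cong toℕ eq))
    ... | inj₂ (inj₁ eq)   = inj₂ (inj₁ (trans (sym (Finₚ.toℕ-fromℕ< _)) (trans (cong toℕ eq) pF≡p)))
    ... | inj₂ (inj₂ eq)   = inj₂ (inj₂ (trans (sym (Finₚ.toℕ-fromℕ< _)) (cong toℕ eq)))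

    p≡1+posA-y : p ≡ suc (toℕ (posA y))
    p≡1+posA-y with span-yℕ (suc (toℕ (posA y))) (ℕₚ.n≤1+n _) (ℕₚ.<⇒≤ (ℕₚ.≤-<-trans ay<p p<by))
      where
      ay<p = proj₁ y-straddles
      p<by = proj₂ y-straddles
    ... | inj₁ eq          = ⊥-elim (ℕₚ.<-irrefl (sym eq) (ℕₚ.n<1+n _))
    ... | inj₂ (inj₁ eq)   = sym eq
    ... | inj₂ (inj₂ eq)   =
      ⊥-elim (ℕₚ.<-irrefl refl
               (ℕₚ.<-≤-trans (proj₂ y-straddles) (subst (_≤ℕ p) eq (proj₁ y-straddles))))

    posB-y≡1+p : toℕ (posB y) ≡ suc p
    posB-y≡1+p with span-yℕ (suc p) (ℕₚ.<⇒≤ (ℕₚ.<-trans (proj₁ y-straddles) (ℕₚ.n<1+n p)))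
                                    (proj₂ y-straddles)
    ... | inj₁ eq          =
      ⊥-elim (ℕₚ.<-irrefl refl (ℕₚ.<-trans (proj₁ y-straddles) (subst (p <ℕ_) eq (ℕₚ.n<1+n p))))
    ... | inj₂ (inj₁ eq)   = ⊥-elim (ℕₚ.<-irrefl (sym eq) (ℕₚ.n<1+n p))
    ... | inj₂ (inj₂ eq)   = sym eq

    y-x-y : let m = toℕ (posA y) in V [ m ]= y × V [ suc m ]= x × V [ suc (suc m) ]= y
    y-x-y = V[]-≡ (posA y) refl (block-posA y) ,
            V[]-≡ pF (trans pF≡p p≡1+posA-y) refl ,
            V[]-≡ (posB y) (trans posB-y≡1+p (cong suc p≡1+posA-y)) (block-posB y)

    module AtStart (pF≡posA-x : pF ≡ posA x) where

      EndsBeforeY : Fin t → Set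
      EndsBeforeY j = toℕ (posB j) <ℕ toℕ (posA y)

      starts-before-y⇒EndsBeforeY : ∀ v → toℕ (posA v) <ℕ toℕ (posA y) → EndsBeforeY v
      starts-before-y⇒EndsBeforeY v av<ay with toℕ (posB v) ℕₚ.<? toℕ (posA y)
      ... | yes bv<ay = bv<ay
      ... | no  bv≮ay with toℕ (posB v) ℕₚ.≤? toℕ (posB y)
      ...   | no bv≰by = ⊥-elim (no-nesting y v (earlier⇒< (val-posA v) (val-posA y) av<ay)
                                                (earlier⇒< (val-posB y) (val-posB v) (ℕₚ.≰⇒> bv≰by)))
      ...   | yes bv≤by with span-y (posB v) (ℕₚ.≮⇒≥ bv≮ay) bv≤by
      ...     | inj₁ eq        = ⊥-elim (posA≢posB (sym eq))
      ...     | inj₂ (inj₁ eq) = ⊥-elim (posA≢posB (sym (trans eq pF≡posA-x)))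
      ...     | inj₂ (inj₂ eq) =
        ⊥-elim (ℕₚ.<-irrefl (cong (λ i → toℕ (posA i)) (posB-injective eq)) av<ay)

      EndsBeforeY-Meet-closed : Meet-closed EndsBeforeY
      EndsBeforeY-Meet-closed u v bu<ay (_ , av≤bu) =
        starts-before-y⇒EndsBeforeY v
          (<⇒earlier (val-posA v) (val-posA y)
                     (ℚₚ.≤-<-trans av≤bu (earlier⇒< (val-posB u) (val-posA y) bu<ay)))

      nothing-before-y : ∀ q → q <ℕ toℕ (posA y) → ⊥
      nothing-before-y q q<ay =
        ℕₚ.<-asym (posA<posB y)
                  (Meet-closed-universal conn EndsBeforeY EndsBeforeY-Meet-closed (block k) y k-ends-before)
        where
        q<m : q <ℕ t + t
        q<m = ℕₚ.<-trans q<ay (Finₚ.toℕ<n (posA y))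
        k = fromℕ< q<m
        k<ay : toℕ k <ℕ toℕ (posA y)
        k<ay = subst (_<ℕ _) (sym (Finₚ.toℕ-fromℕ< q<m)) q<ay
        k-ends-before : EndsBeforeY (block k)
        k-ends-before with posA-or-posB k
        ... | inj₁ k≡ =
          starts-before-y⇒EndsBeforeY (block k) (subst (λ k → toℕ k <ℕ toℕ (posA y)) k≡ k<ay)
        ... | inj₂ k≡ = subst (λ k → toℕ k <ℕ toℕ (posA y)) k≡ k<ay

      posA-y≡0 : toℕ (posA y) ≡ 0
      posA-y≡0 = ℕₚ.n≤0⇒n≡0 (ℕₚ.≮⇒≥ (nothing-before-y 0))

      y≡0 : toℕ y ≡ 0
      y≡0 = toℕ-least y (λ z → ℕₚ.≮⇒≥ (λ z<y →
              ℕₚ.n≮0 (subst (toℕ (posA z) <ℕ_) posA-y≡0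
                             (<⇒earlier (val-posA z) (val-posA y) (a-incr z y z<y)))))

      posA-x≡1+posA-y : toℕ (posA x) ≡ suc (toℕ (posA y))
      posA-x≡1+posA-y = trans (cong toℕ (sym pF≡posA-x)) (trans pF≡p p≡1+posA-y)

      x≡1 : toℕ x ≡ 1
      x≡1 = trans (sym (toℕ-successor y x y<x nothing-between)) (cong suc y≡0)
        where
        y<x : toℕ y <ℕ toℕ x
        y<x = strictMono⇒reflects-< a-incr (earlier⇒< (val-posA y) (val-posA x)
                                  (subst (toℕ (posA y) <ℕ_) (sym posA-x≡1+posA-y) (ℕₚ.n<1+n _)))
        nothing-between : ∀ z → toℕ y <ℕ toℕ z → toℕ z <ℕ toℕ x → ⊥
        nothing-between z y<z z<x =
          ℕₚ.<⇒≱ (<⇒earlier (val-posA y) (val-posA z) (a-incr y z y<z))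
                 (ℕₚ.m<1+n⇒m≤n (subst (toℕ (posA z) <ℕ_) posA-x≡1+posA-y
                                  (<⇒earlier (val-posA z) (val-posA x) (a-incr z x z<x))))

      conclusion : (∃[ rest ] (map toℕ V ≡ 0 ∷ 1 ∷ 0 ∷ rest))
                   × (∀ i → Nbr i ⇔ (toℕ i ≡ 0 ⊎ toℕ i ≡ 1))
      conclusion =
        (map toℕ rest , trans (cong (map toℕ) V≡yxy) (cong₂ (λ u v → u ∷ v ∷ u ∷ map toℕ rest) y≡0 x≡1)) ,
        λ i → subst₂ (λ c d → Nbr i ⇔ (toℕ i ≡ c ⊎ toℕ i ≡ d)) y≡0 x≡1
                     (⇔.trans (Nbr⇔x⊎y i) (↔⇒⇔ (⊎-comm _ _)))
        where
        yxy = y-x-y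
        V-prefix = []=-prefix (subst (V [_]= y) posA-y≡0 (proj₁ yxy))
                              (subst (λ m → V [ suc m ]= x) posA-y≡0 (proj₁ (proj₂ yxy)))
                              (subst (λ m → V [ suc (suc m) ]= y) posA-y≡0 (proj₂ (proj₂ yxy)))
        rest = proj₁ V-prefix
        V≡yxy = proj₂ V-prefix

    module AtEnd (pF≡posB-x : pF ≡ posB x) where

      StartsAfterY : Fin t → Set
      StartsAfterY j = toℕ (posB y) <ℕ toℕ (posA j)

      ends-after-y⇒StartsAfterY : ∀ v → toℕ (posB y) <ℕ toℕ (posB v) → StartsAfterY v
      ends-after-y⇒StartsAfterY v by<bv with toℕ (posB y) ℕₚ.<? toℕ (posA v)
      ... | yes by<av = by<av
      ... | no  by≮av with toℕ (posA y) ℕₚ.≤? toℕ (posA v)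
      ...   | no ay≰av = ⊥-elim (no-nesting y v (earlier⇒< (val-posA v) (val-posA y) (ℕₚ.≰⇒> ay≰av))
                                                (earlier⇒< (val-posB y) (val-posB v) by<bv))
      ...   | yes ay≤av with span-y (posA v) ay≤av (ℕₚ.≮⇒≥ by≮av)
      ...     | inj₁ eq        =
        ⊥-elim (ℕₚ.<-irrefl (cong (λ i → toℕ (posB i)) (sym (posA-injective eq))) by<bv)
      ...     | inj₂ (inj₁ eq) = ⊥-elim (posA≢posB (trans eq pF≡posB-x))
      ...     | inj₂ (inj₂ eq) = ⊥-elim (posA≢posB eq)

      StartsAfterY-Meet-closed : Meet-closed StartsAfterY
      StartsAfterY-Meet-closed u v by<au (au≤bv , _) =
        ends-after-y⇒StartsAfterY v
          (<⇒earlier (val-posB y) (val-posB v)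
                     (ℚₚ.<-≤-trans (earlier⇒< (val-posB y) (val-posA u) by<au) au≤bv))

      nothing-after-y : ∀ q → toℕ (posB y) <ℕ q → q <ℕ t + t → ⊥
      nothing-after-y q by<q q<m =
        ℕₚ.<-asym (posA<posB y)
                  (Meet-closed-universal conn StartsAfterY StartsAfterY-Meet-closed (block k) y k-starts-after)
        where
        k = fromℕ< q<m
        by<k : toℕ (posB y) <ℕ toℕ k
        by<k = subst (_ <ℕ_) (sym (Finₚ.toℕ-fromℕ< q<m)) by<q
        k-starts-after : StartsAfterY (block k)
        k-starts-after with posA-or-posB k
        ... | inj₁ k≡ = subst (λ k → toℕ (posB y) <ℕ toℕ k) k≡ by<k
        ... | inj₂ k≡ =
          ends-after-y⇒StartsAfterY (block k) (subst (λ k → toℕ (posB y) <ℕ toℕ k) k≡ by<k)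

      posB-y-last : suc (toℕ (posB y)) ≡ t + t
      posB-y-last = ℕₚ.≤-antisym (Finₚ.toℕ<n (posB y))
                                 (ℕₚ.≮⇒≥ (nothing-after-y (suc (toℕ (posB y))) (ℕₚ.n<1+n _)))

      y≡t∸1 : toℕ y ≡ t ∸ 1
      y≡t∸1 = toℕ-greatest y (λ z → ℕₚ.≮⇒≥ (λ y<z →
                nothing-after-y (toℕ (posB z)) (<⇒earlier (val-posB y) (val-posB z) (b-incr y z y<z))
                                (Finₚ.toℕ<n (posB z))))

      posB-y≡1+posB-x : toℕ (posB y) ≡ suc (toℕ (posB x))
      posB-y≡1+posB-x = trans posB-y≡1+p (cong suc (trans (sym pF≡p) (cong toℕ pF≡posB-x)))

      x≡t∸2 : toℕ x ≡ t ∸ 2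
      x≡t∸2 = trans (cong (_∸ 1) (trans (toℕ-successor x y x<y nothing-between) y≡t∸1))
                    (ℕₚ.∸-+-assoc t 1 1)
        where
        x<y : toℕ x <ℕ toℕ y
        x<y = strictMono⇒reflects-< b-incr (earlier⇒< (val-posB x) (val-posB y)
                                  (subst (toℕ (posB x) <ℕ_) (sym posB-y≡1+posB-x) (ℕₚ.n<1+n _)))
        nothing-between : ∀ z → toℕ x <ℕ toℕ z → toℕ z <ℕ toℕ y → ⊥
        nothing-between z x<z z<y =
          ℕₚ.<⇒≱ (<⇒earlier (val-posB x) (val-posB z) (b-incr x z x<z))
                 (ℕₚ.m<1+n⇒m≤n (subst (toℕ (posB z) <ℕ_) posB-y≡1+posB-x
                                  (<⇒earlier (val-posB z) (val-posB y) (b-incr z y z<y))))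

      conclusion : (∃[ pre ] (map toℕ V ≡ pre ++ (t ∸ 1) ∷ (t ∸ 2) ∷ (t ∸ 1) ∷ []))
                   × (∀ i → Nbr i ⇔ (toℕ i ≡ t ∸ 2 ⊎ toℕ i ≡ t ∸ 1))
      conclusion = (map toℕ pre , trans (cong (map toℕ) V≡yxy)
                                    (trans (Listₚ.map-++ toℕ pre _)
                                           (cong₂ (λ u v → map toℕ pre ++ u ∷ v ∷ u ∷ []) y≡t∸1 x≡t∸2))) ,
                   λ i → subst₂ (λ c d → Nbr i ⇔ (toℕ i ≡ c ⊎ toℕ i ≡ d)) x≡t∸2 y≡t∸1 (Nbr⇔x⊎y i)
        where
        yxy = y-x-y
        length-V≡ : length V ≡ suc (suc (suc (toℕ (posA y))))
        length-V≡ = trans length-V (trans (sym posB-y-last)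
                                          (cong suc (trans posB-y≡1+p (cong suc p≡1+posA-y))))
        V-suffix = []=-suffix (proj₁ yxy) (proj₁ (proj₂ yxy)) (proj₂ (proj₂ yxy)) length-V≡
        pre = proj₁ V-suffix
        V≡yxy = proj₂ V-suffix

  neighbour-other-than-x : (∃[ i ] ∃[ j ] (i ≢ j × Nbr i × Nbr j)) → ∃[ y ] (Nbr y × y ≢ x)
  neighbour-other-than-x (i , j , i≢j , Nbr-i , Nbr-j) with i Finₚ.≟ x
  ... | yes refl = j , Nbr-j , λ j≡x → i≢j (sym j≡x)
  ... | no  i≢x  = i , Nbr-i , i≢x

  conclusion : (∃[ i ] ∃[ j ] (i ≢ j × Nbr i × Nbr j)) →
               ((∃[ rest ] (map toℕ V ≡ 0 ∷ 1 ∷ 0 ∷ rest))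
                  × (∀ i → Nbr i ⇔ (toℕ i ≡ 0 ⊎ toℕ i ≡ 1)))
               ⊎
               ((∃[ pre ] (map toℕ V ≡ pre ++ (t ∸ 1) ∷ (t ∸ 2) ∷ (t ∸ 1) ∷ []))
                  × (∀ i → Nbr i ⇔ (toℕ i ≡ t ∸ 2 ⊎ toℕ i ≡ t ∸ 1)))
  conclusion two-nbrs with neighbour-other-than-x two-nbrs | posA-or-posB pF
  ... | y , Nbr-y , y≢x | inj₁ pF≡posA-x = inj₁ (Pair.AtStart.conclusion y Nbr-y y≢x pF≡posA-x)
  ... | y , Nbr-y , y≢x | inj₂ pF≡posB-x = inj₂ (Pair.AtEnd.conclusion y Nbr-y y≢x pF≡posB-x)

corollary3p11 : ∀ {n : ℕ} (G : Graph n) → IsPTPIG G → ConnectedP G →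
    ∀ (t : ℕ) (blk : Fin n → Fin t) → IsBlockMap G t blk →
    ∀ (a b : Fin t → ℚ) → IsCanonicalRep G blk a b →
    ∀ (V : List (Fin t)) → IsVertexCanonicalSeq a b V →
    ∀ (w : Fin n) → NonProbe G w →
    (∃[ i ] ∃[ j ] (i ≢ j × BlockNeighbor G blk w i × BlockNeighbor G blk w j)) →
    ∀ (T₁ T₂ : BlockSubstring V) →
    IsPerfectFor G blk w T₁ → IsPerfectFor G blk w T₂ →
    IntersectExactlyOnce T₁ T₂ →
    ((∃[ rest ] (map toℕ V ≡ 0 ∷ 1 ∷ 0 ∷ rest))
    × (∀ i → BlockNeighbor G blk w i ⇔ (toℕ i ≡ 0 ⊎ toℕ i ≡ 1)))
    ⊎
    ((∃[ pre ] (map toℕ V ≡ pre ++ (t ∸ 1) ∷ (t ∸ 2) ∷ (t ∸ 1) ∷ []))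
    × (∀ i → BlockNeighbor G blk w i ⇔ (toℕ i ≡ t ∸ 2 ⊎ toℕ i ≡ t ∸ 1)))
corollary3p11 G _ conn t blk bm a b cr V (e , e-onto , e-sorted , V≡) w _ two-nbrs
              T₁ T₂ perfect₁ perfect₂ (p , p∈T₁ , p∈T₂ , only-p)
  with ℕₚ.≤-total (length (BlockSubstring.pre T₁)) (length (BlockSubstring.pre T₂))
... | inj₁ T₁-first =
  TwoPerfectSubstrings.conclusion conn bm cr e e-onto e-sorted V≡ w T₁ T₂ perfect₁ perfect₂
                                  p∈T₁ p∈T₂ only-p T₁-first two-nbrs
... | inj₂ T₂-first =
  TwoPerfectSubstrings.conclusion conn bm cr e e-onto e-sorted V≡ w T₂ T₁ perfect₂ perfect₁
                                  p∈T₂ p∈T₁ (λ q q∈T₂ q∈T₁ → only-p q q∈T₁ q∈T₂) T₂-first two-nbrs
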